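{- Let $X=\{a_1,\dots,a_n\}$ and let $\mathcal{F}$ be a union-closed family of subsets of $X$ with $\bigcup_{f\in\mathcal{F}}f=X$. Let $w=a_1a_2\cdots a_n$ and $\mathcal{U}=\varphi_w(\mathcal{F})$. Then $$|J(\mathcal{F})|\le 2|\min(\mathcal{U})|+|\min(\mathcal{U}\setminus\min(\mathcal{U}))|.$$
   Context: A family $\mathcal{F}$ is union-closed if $f,g\in\mathcal{F}$ implies $f\cup g\in\mathcal{F}$. $J(\mathcal{F})$ is the set of $g\in\mathcal{F}$ such that $g=h\cup t$ with $h,t\in\mathcal{F}$ implies $h=g$ or $t=g$. For a family $\mathcal{B}$, $\min(\mathcal{B})$ is its set of inclusion-minimal members. Rising functions: for $S\subseteq 2^X$ and $a\in X$, $\varphi_{S,a}:S\to 2^X$ is $\varphi_{S,a}(z)=z\cup\{a\}$ if $z\cup\{a\}\notin S$, and $\varphi_{S,a}(z)=z$ otherwise. For a word $u=b_1\cdots b_n$ listing the elements of $X$ in some order, put $\varphi_0=\mathrm{id}$, $S_0=S$ and, for $1\le j\le n$, $\varphi_j=\varphi_{S_{j-1},b_j}\circ\varphi_{j-1}$, $S_j=\varphi_j(S)$; then $\varphi_u:=\varphi_n:S\to 2^X$ is the rising function of $S$ with respect to $u$. -}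

module Defs where

open import Data.Nat using (ℕ)
open import Data.Bool using (Bool)
open import Data.Fin using (Fin)
open import Data.Fin.Subset using (Subset; _∪_; _⊆_; ⁅_⁆)
open import Data.Fin.Subset.Properties using (_⊆?_)
open import Data.List using (List; []; _∷_; filter; map; deduplicate; allFin)
open import Data.List.Relation.Unary.All using (All; all?)
open import Data.Sum using (_⊎_)
open import Data.Vec.Properties using (≡-dec)
open import Relation.Binary.PropositionalEquality using (_≡_)
open import Relation.Binary.Definitions using (DecidableEquality)
open import Relation.Nullary using (Dec; yes; no; ¬_; ¬?)
open import Relation.Nullary.Decidable using (_→-dec_; _⊎-dec_)
import Data.Bool.Properties as BoolP
import Data.List.Membership.DecPropositional as DecMem

-- Subsets of X = {a_1,...,a_n} are represented as Subset n (a_i = the i-th element of Fin n).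
-- A family of subsets is a List (Subset n); as a set it is taken without repetitions.

_≟ₛ_ : ∀ {n} → DecidableEquality (Subset n)
_≟ₛ_ = ≡-dec BoolP._≟_

module _ {n : ℕ} where
  open DecMem (_≟ₛ_ {n}) using (_∈_; _∉_; _∈?_)

  UnionClosed : List (Subset n) → Set
  UnionClosed F = ∀ {f g} → f ∈ F → g ∈ F → (f ∪ g) ∈ F

  IsJ : List (Subset n) → Subset n → Set
  IsJ F g = All (λ h → All (λ t → g ≡ h ∪ t → (h ≡ g ⊎ t ≡ g)) F) F

  IsJ? : (F : List (Subset n)) → (g : Subset n) → Dec (IsJ F g)
  IsJ? F g = all? (λ h → all? (λ t → (g ≟ₛ (h ∪ t)) →-dec ((h ≟ₛ g) ⊎-dec (t ≟ₛ g))) F) F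

  J : List (Subset n) → List (Subset n)
  J F = filter (IsJ? F) F

  IsMin : List (Subset n) → Subset n → Set
  IsMin B b = All (λ c → c ⊆ b → c ≡ b) B

  IsMin? : (B : List (Subset n)) → (b : Subset n) → Dec (IsMin B b)
  IsMin? B b = all? (λ c → (c ⊆? b) →-dec (c ≟ₛ b)) B

  minimal : List (Subset n) → List (Subset n)
  minimal B = filter (IsMin? B) B

  _∖_ : List (Subset n) → List (Subset n) → List (Subset n)
  B ∖ C = filter (λ b → ¬? (b ∈? C)) B

  φ : List (Subset n) → Fin n → Subset n → Subset n
  φ S a z with (z ∪ ⁅ a ⁆) ∈? S
  ... | yes _ = z
  ... | no  _ = z ∪ ⁅ a ⁆

  step : List (Subset n) → Fin n → List (Subset n)
  step S a = deduplicate _≟ₛ_ (map (φ S a) S)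

  -- φ_u(S) for a word u (list of elements of X): S_n where S_0 = S
  -- (since φ_j = φ_{S_{j-1},b_j} ∘ φ_{j-1}, we have S_j = φ_{S_{j-1},b_j}(S_{j-1}))
  risingImage : List (Fin n) → List (Subset n) → List (Subset n)
  risingImage []       S = deduplicate _≟ₛ_ S
  risingImage (a ∷ u)  S = risingImage u (step S a)

  w : List (Fin n)
  w = allFin n

module Submission where

-- For a duplicate-free union-closed S, a point a, and T = φ_{S,a}(S), the
-- potential Ψ(S) = |J(S)| + |min(S)| satisfies Ψ(S) ≤ Ψ(T):
--   * φ = φ_{S,a} is injective on S and maps min(S) into min(T);
--   * if g ∈ J(S) but φ(g) ∉ J(T), then g has a "defect": a ∈ g and the
--     residue g - a lies in S, is minimal in T, and is not minimal in S;
--   * so φ maps the good part of J(S) injectively into J(T), while min(S)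
--     (via φ) and the bad part of J(S) (via g ↦ g - a) inject disjointly
--     into min(T).
-- A step also keeps S union-closed, keeps closure under adding earlier
-- letters and adds closure under a; hence U = φ_w(F) is an up-set.  In an
-- up-set every irreducible is minimal or minimal in U ∖ min(U), whence
--   |J(F)| ≤ Ψ(F) ≤ Ψ(U) ≤ 2|min(U)| + |min(U ∖ min(U))|.

open import Defs
import Algebra.Solver.IdempotentCommutativeMonoid as ICMSolver
open import Data.Empty using (⊥; ⊥-elim)
open import Data.Fin using (Fin) renaming (_≟_ to _≟ᶠ_)
open import Data.Fin.Properties using (¬∀⟶∃¬)
open import Data.Fin.Subset
  using (Subset; ⋃; ⊤; _∪_; ⁅_⁆; _⊆_; _-_; outside)
  renaming (_∈_ to _∈ₛ_; _∉_ to _∉ₛ_; _─_ to _─ₛ_)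
open import Data.Fin.Subset.Properties
  using ( x∈p∪q⁻; p⊆p∪q; q⊆p∪q; x∈⁅x⁆; x∈⁅y⁆⇒x≡y; ⊆-antisym
        ; p─q⊆p; x∈p∧x≢y⇒x∈p-y; ∪-assoc; ∪-comm; ∪-idempotentCommutativeMonoid )
  renaming (_∈?_ to _∈ₛ?_; _⊆?_ to _⊆ₛ?_)
open import Data.List
  using (List; []; _∷_; length; map; filter; _++_; deduplicate; allFin)
open import Data.List.Membership.Propositional using (_∈_; _∉_; _─_; find)
open import Data.List.Membership.Propositional.Properties
  using ( ∈-map⁺; ∈-map⁻; ∈-filter⁺; ∈-filter⁻; ∈-++⁺ˡ; ∈-++⁺ʳ; ∈-++⁻
        ; ∈-deduplicate⁺; ∈-deduplicate⁻; ∈-allFin )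
open import Data.List.Properties using (length-map; length-++; length-removeAt′; filter-all)
open import Data.List.Relation.Unary.All as All using (All; []; _∷_)
open import Data.List.Relation.Unary.All.Properties as AllP using (¬All⇒Any¬)
open import Data.List.Relation.Unary.AllPairs using ([]; _∷_)
open import Data.List.Relation.Unary.Any using (here; there; index)
open import Data.List.Relation.Unary.Unique.Propositional using (Unique)
import Data.List.Relation.Unary.Unique.Propositional.Properties as UniqueP
import Data.List.Relation.Unary.Unique.DecPropositional.Properties as UniqueDecP
import Data.List.Membership.DecPropositional as DecMembership
open import Data.Nat using (ℕ; suc; _≤_; _+_; _*_; z≤n; s≤s)
open import Data.Nat.Properties
  using (≤-trans; ≤-reflexive; +-mono-≤; +-monoˡ-≤; m≤m+n; +-suc; +-assoc; +-comm; module ≤-Reasoning)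
open import Data.Nat.Tactic.RingSolver using (solve-∀)
open import Data.Product using (∃-syntax; _×_; _,_; proj₁; proj₂)
open import Data.Sum using (_⊎_; inj₁; inj₂; [_,_]′)
open import Data.Vec using (_∷_; here; there)
open import Function using (_∘_)
open import Relation.Binary.PropositionalEquality
  using (_≡_; _≢_; refl; sym; trans; cong; cong₂; subst; module ≡-Reasoning)
open import Relation.Nullary using (Dec; yes; no; ¬_; ¬?)
open import Relation.Nullary.Decidable using (_→-dec_; _⊎-dec_)
open import Relation.Unary using (Pred; Decidable)

module _ {A : Set} where

  ∈-─ : ∀ {x y} {ys : List A} (x∈ys : x ∈ ys) → y ∈ ys → y ≢ x → y ∈ ys ─ x∈ys
  ∈-─ (here refl) (here refl)  y≢x = ⊥-elim (y≢x refl)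
  ∈-─ (here refl) (there y∈ys) _   = y∈ys
  ∈-─ (there _)   (here refl)  _   = here refl
  ∈-─ (there x∈ys) (there y∈ys) y≢x = there (∈-─ x∈ys y∈ys y≢x)

  unique-⊆-length : ∀ {xs ys : List A} → Unique xs → (∀ {x} → x ∈ xs → x ∈ ys) →
                    length xs ≤ length ys
  unique-⊆-length {[]}     _           _   = z≤n
  unique-⊆-length {x ∷ xs} {ys} (x∉xs ∷ uxs) sub = begin
    suc (length xs)          ≤⟨ s≤s (unique-⊆-length uxs sub′) ⟩
    suc (length (ys ─ x∈ys)) ≡⟨ sym (length-removeAt′ ys (index x∈ys)) ⟩
    length ys                ∎
    where
    open ≤-Reasoning
    x∈ys : x ∈ ys
    x∈ys = sub (here refl)
    sub′ : ∀ {y} → y ∈ xs → y ∈ ys ─ x∈ys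
    sub′ y∈xs = ∈-─ x∈ys (sub (there y∈xs)) (λ y≡x → All.lookup x∉xs y∈xs (sym y≡x))

  length-filter-split : ∀ {ℓ} {P : Pred A ℓ} (P? : Decidable P) (xs : List A) →
    length xs ≡ length (filter P? xs) + length (filter (¬? ∘ P?) xs)
  length-filter-split P? [] = refl
  length-filter-split P? (x ∷ xs) with P? x
  ... | yes _ = cong suc (length-filter-split P? xs)
  ... | no  _ = trans (cong suc (length-filter-split P? xs)) (sym (+-suc _ _))

  counterexample : ∀ {ℓ} {P : Pred A ℓ} → Decidable P → ∀ {xs} → ¬ All P xs →
                   ∃[ x ] (x ∈ xs × ¬ P x)
  counterexample P? {xs} ¬all = find (¬All⇒Any¬ P? xs ¬all)

  deduplicate-unique : ∀ (_≟_ : (x y : A) → Dec (x ≡ y)) {xs} → Unique xs →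
                       deduplicate _≟_ xs ≡ xs
  deduplicate-unique _≟_ {[]}     [] = refl
  deduplicate-unique _≟_ {x ∷ xs} (x∉xs ∷ uxs) = cong (x ∷_) (begin
    filter (¬? ∘ (x ≟_)) (deduplicate _≟_ xs) ≡⟨ filter-all (¬? ∘ (x ≟_)) (AllP.deduplicate⁺ _≟_ x∉xs) ⟩
    deduplicate _≟_ xs                      ≡⟨ deduplicate-unique _≟_ uxs ⟩
    xs                                      ∎)
    where open ≡-Reasoning

module _ {A B : Set} where

  InjectiveOn : (A → B) → List A → Set
  InjectiveOn f xs = ∀ {x y} → x ∈ xs → y ∈ xs → f x ≡ f y → x ≡ y

  map-unique : ∀ {f : A → B} {xs} → InjectiveOn f xs → Unique xs → Unique (map f xs)
  map-unique {xs = []}     _   []           = []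
  map-unique {xs = x ∷ xs} inj (x∉xs ∷ uxs) =
    AllP.map⁺ (All.tabulate (λ y∈xs fx≡fy → All.lookup x∉xs y∈xs (inj (here refl) (there y∈xs) fx≡fy)))
    ∷ map-unique (λ x∈ y∈ → inj (there x∈) (there y∈)) uxs

  map-⊆ : ∀ (f : A → B) {xs ys} → (∀ {x} → x ∈ xs → f x ∈ ys) → ∀ {v} → v ∈ map f xs → v ∈ ys
  map-⊆ f into v∈ with ∈-map⁻ f v∈
  ... | x , x∈xs , refl = into x∈xs

  injection-length : ∀ (f : A → B) {xs ys} → Unique xs → InjectiveOn f xs →
                     (∀ {x} → x ∈ xs → f x ∈ ys) → length xs ≤ length ys
  injection-length f {xs} {ys} uxs inj into = begin
    length xs         ≡⟨ sym (length-map f xs) ⟩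
    length (map f xs) ≤⟨ unique-⊆-length (map-unique inj uxs) (map-⊆ f into) ⟩
    length ys         ∎
    where open ≤-Reasoning

  disjoint-injections-length : ∀ (f g : A → B) {xs zs ys} → Unique xs → Unique zs →
    InjectiveOn f xs → InjectiveOn g zs → (∀ {x z} → x ∈ xs → z ∈ zs → f x ≢ g z) →
    (∀ {x} → x ∈ xs → f x ∈ ys) → (∀ {z} → z ∈ zs → g z ∈ ys) →
    length xs + length zs ≤ length ys
  disjoint-injections-length f g {xs} {zs} {ys} uxs uzs injf injg apart intof intog = begin
    length xs + length zs                 ≡⟨ sym (cong₂ _+_ (length-map f xs) (length-map g zs)) ⟩
    length (map f xs) + length (map g zs) ≡⟨ sym (length-++ (map f xs)) ⟩
    length (map f xs ++ map g zs)         ≤⟨ unique-⊆-length unique sub ⟩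
    length ys                             ∎
    where
    open ≤-Reasoning
    disjoint : ∀ {v} → ¬ (v ∈ map f xs × v ∈ map g zs)
    disjoint (v∈f , v∈g) with ∈-map⁻ f v∈f | ∈-map⁻ g v∈g
    ... | x , x∈xs , refl | z , z∈zs , fx≡gz = apart x∈xs z∈zs fx≡gz
    unique : Unique (map f xs ++ map g zs)
    unique = UniqueP.++⁺ (map-unique injf uxs) (map-unique injg uzs) disjoint
    sub : ∀ {v} → v ∈ map f xs ++ map g zs → v ∈ ys
    sub v∈ = [ map-⊆ f intof , map-⊆ g intog ]′ (∈-++⁻ (map f xs) v∈)

module _ {n : ℕ} where

  open ICMSolver (∪-idempotentCommutativeMonoid n) using (solve; _⊜_; _⊕_)

  ∪-swapʳ : (p q r : Subset n) → (p ∪ q) ∪ r ≡ (p ∪ r) ∪ q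
  ∪-swapʳ = solve 3 (λ p q r → (p ⊕ q) ⊕ r ⊜ (p ⊕ r) ⊕ q) refl

  ∪-distribʳ-self : (p q r : Subset n) → (p ∪ r) ∪ (q ∪ r) ≡ (p ∪ q) ∪ r
  ∪-distribʳ-self = solve 3 (λ p q r → (p ⊕ r) ⊕ (q ⊕ r) ⊜ (p ⊕ q) ⊕ r) refl

  ∪-idemʳ : (p q : Subset n) → (p ∪ q) ∪ q ≡ p ∪ q
  ∪-idemʳ = solve 2 (λ p q → (p ⊕ q) ⊕ q ⊜ p ⊕ q) refl

  ⊆⇒∪≡ : ∀ {p q : Subset n} → p ⊆ q → p ∪ q ≡ q
  ⊆⇒∪≡ {p} {q} p⊆q = ⊆-antisym (λ x∈ → [ p⊆q , (λ x∈q → x∈q) ]′ (x∈p∪q⁻ p q x∈)) (q⊆p∪q p q)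

  a∈p∪⁅a⁆ : ∀ (p : Subset n) a → a ∈ₛ p ∪ ⁅ a ⁆
  a∈p∪⁅a⁆ p a = q⊆p∪q p ⁅ a ⁆ (x∈⁅x⁆ a)

  ∪⁅⁆-absorb : ∀ {p : Subset n} {a} → a ∈ₛ p → p ∪ ⁅ a ⁆ ≡ p
  ∪⁅⁆-absorb {p} {a} a∈p = trans (∪-comm p ⁅ a ⁆) (⊆⇒∪≡ (λ x∈ → subst (_∈ₛ p) (sym (x∈⁅y⁆⇒x≡y a x∈)) a∈p))

  ⊆∪⁅⁆⇒⊆ : ∀ {p q : Subset n} {a} → a ∉ₛ p → p ⊆ q ∪ ⁅ a ⁆ → p ⊆ q
  ⊆∪⁅⁆⇒⊆ {p} {q} {a} a∉p p⊆ x∈p with x∈p∪q⁻ q ⁅ a ⁆ (p⊆ x∈p)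
  ... | inj₁ x∈q = x∈q
  ... | inj₂ x∈a = ⊥-elim (a∉p (subst (_∈ₛ p) (x∈⁅y⁆⇒x≡y a x∈a) x∈p))

  ∪⁅⁆-cancel : ∀ {p q : Subset n} {a} → a ∉ₛ p → a ∉ₛ q → p ∪ ⁅ a ⁆ ≡ q ∪ ⁅ a ⁆ → p ≡ q
  ∪⁅⁆-cancel {p} {q} a∉p a∉q eq = ⊆-antisym
    (⊆∪⁅⁆⇒⊆ a∉p (λ x∈ → subst (_ ∈ₛ_) eq (p⊆p∪q _ x∈)))
    (⊆∪⁅⁆⇒⊆ a∉q (λ x∈ → subst (_ ∈ₛ_) (sym eq) (p⊆p∪q _ x∈)))

  ∈─⇒∉ : ∀ {m} {x : Fin m} (p q : Subset m) → x ∈ₛ p ─ₛ q → x ∉ₛ q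
  ∈─⇒∉ (_ ∷ p) (outside ∷ q) here        ()
  ∈─⇒∉ (_ ∷ p) (_       ∷ q) (there x∈) (there x∈q) = ∈─⇒∉ p q x∈ x∈q

  x∉p-x : ∀ (p : Subset n) x → x ∉ₛ p - x
  x∉p-x p x x∈ = ∈─⇒∉ p ⁅ x ⁆ x∈ (x∈⁅x⁆ x)

  p-x≢p : ∀ {p : Subset n} {x} → x ∈ₛ p → p - x ≢ p
  p-x≢p {p} {x} x∈p eq = x∉p-x p x (subst (x ∈ₛ_) (sym eq) x∈p)

  ⊆-remove : ∀ {p q : Subset n} {x} → p ⊆ q → x ∉ₛ p → p ⊆ q - x
  ⊆-remove p⊆q x∉p y∈p = x∈p∧x≢y⇒x∈p-y (p⊆q y∈p) (λ { refl → x∉p y∈p })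

  -∪⁅⁆ : ∀ {p : Subset n} {a} → a ∈ₛ p → (p - a) ∪ ⁅ a ⁆ ≡ p
  -∪⁅⁆ {p} {a} a∈p = ⊆-antisym back forth
    where
    back : (p - a) ∪ ⁅ a ⁆ ⊆ p
    back x∈ = [ p─q⊆p p ⁅ a ⁆ , (λ x∈a → subst (_∈ₛ p) (sym (x∈⁅y⁆⇒x≡y a x∈a)) a∈p) ]′
                (x∈p∪q⁻ (p - a) ⁅ a ⁆ x∈)
    forth : p ⊆ (p - a) ∪ ⁅ a ⁆
    forth {x} x∈p with x ≟ᶠ a
    ... | yes refl = a∈p∪⁅a⁆ (p - a) a
    ... | no  x≢a  = p⊆p∪q ⁅ a ⁆ (x∈p∧x≢y⇒x∈p-y x∈p x≢a)

  ∪⁅⁆- : ∀ {p : Subset n} {a} → a ∉ₛ p → (p ∪ ⁅ a ⁆) - a ≡ p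
  ∪⁅⁆- {p} {a} a∉p = ∪⁅⁆-cancel (x∉p-x (p ∪ ⁅ a ⁆) a) a∉p (-∪⁅⁆ (a∈p∪⁅a⁆ p a))

  split-by-two : ∀ (p : Subset n) {x y} → x ≢ y → p ≡ (p - x) ∪ (p - y)
  split-by-two p {x} {y} x≢y = ⊆-antisym forth back
    where
    back : (p - x) ∪ (p - y) ⊆ p
    back i∈ = [ p─q⊆p p ⁅ x ⁆ , p─q⊆p p ⁅ y ⁆ ]′ (x∈p∪q⁻ (p - x) (p - y) i∈)
    forth : p ⊆ (p - x) ∪ (p - y)
    forth {i} i∈p with i ≟ᶠ x
    ... | yes refl = q⊆p∪q (p - x) (p - y) (x∈p∧x≢y⇒x∈p-y i∈p x≢y)
    ... | no  i≢x  = p⊆p∪q (p - y) (x∈p∧x≢y⇒x∈p-y i∈p i≢x)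

  missing-point : ∀ {p q : Subset n} → p ⊆ q → p ≢ q → ∃[ x ] (x ∈ₛ q × x ∉ₛ p)
  missing-point {p} {q} p⊆q p≢q
    with ¬∀⟶∃¬ n (λ x → x ∈ₛ q → x ∈ₛ p) (λ x → (x ∈ₛ? q) →-dec (x ∈ₛ? p))
                 (λ q⊆p → p≢q (⊆-antisym p⊆q (λ {x} → q⊆p x)))
  ... | x , q⊈p with x ∈ₛ? q
  ...   | yes x∈q = x , x∈q , (λ x∈p → q⊈p (λ _ → x∈p))
  ...   | no  x∉q = ⊥-elim (q⊈p (λ x∈q → ⊥-elim (x∉q x∈q)))

module _ {n : ℕ} where

  irreducible : ∀ {S : List (Subset n)} {g h t} → IsJ S g → h ∈ S → t ∈ S →
                g ≡ h ∪ t → h ≡ g ⊎ t ≡ g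
  irreducible gJ h∈S t∈S = All.lookup (All.lookup gJ h∈S) t∈S

  minimal-below : ∀ {B : List (Subset n)} {b c} → IsMin B b → c ∈ B → c ⊆ b → c ≡ b
  minimal-below b-min = All.lookup b-min

  ∈-J⁻ : ∀ {S : List (Subset n)} {g} → g ∈ J S → g ∈ S × IsJ S g
  ∈-J⁻ = ∈-filter⁻ (IsJ? _)

  ∈-minimal⁻ : ∀ {B : List (Subset n)} {b} → b ∈ minimal B → b ∈ B × IsMin B b
  ∈-minimal⁻ = ∈-filter⁻ (IsMin? _)

  ∈-minimal⁺ : ∀ {B : List (Subset n)} {b} → b ∈ B → IsMin B b → b ∈ minimal B
  ∈-minimal⁺ = ∈-filter⁺ (IsMin? _)

  reducible : ∀ {S : List (Subset n)} {v} → v ∈ S → v ∉ J S →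
    ∃[ h ] ∃[ t ] (h ∈ S × t ∈ S × v ≡ h ∪ t × h ≢ v × t ≢ v)
  reducible {S} {v} v∈S v∉J
    with counterexample (λ h → All.all? (λ t → (v ≟ₛ (h ∪ t)) →-dec ((h ≟ₛ v) ⊎-dec (t ≟ₛ v))) S)
                        (λ vJ → v∉J (∈-filter⁺ (IsJ? S) v∈S vJ))
  ... | h , h∈S , ¬allt
    with counterexample (λ t → (v ≟ₛ (h ∪ t)) →-dec ((h ≟ₛ v) ⊎-dec (t ≟ₛ v))) ¬allt
  ...   | t , t∈S , ¬split with v ≟ₛ (h ∪ t)
  ...     | yes v≡ = h , t , h∈S , t∈S , v≡ , (λ e → ¬split (λ _ → inj₁ e)) , (λ e → ¬split (λ _ → inj₂ e))
  ...     | no  v≢ = ⊥-elim (¬split (λ v≡ → ⊥-elim (v≢ v≡)))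

  non-minimal : ∀ {B : List (Subset n)} {b} → b ∈ B → b ∉ minimal B →
    ∃[ c ] (c ∈ B × c ⊆ b × c ≢ b)
  non-minimal {B} {b} b∈B b∉min
    with counterexample (λ c → (c ⊆ₛ? b) →-dec (c ≟ₛ b)) (λ bmin → b∉min (∈-minimal⁺ b∈B bmin))
  ... | c , c∈B , ¬below with c ⊆ₛ? b
  ...   | yes c⊆b = c , c∈B , c⊆b , (λ e → ¬below (λ _ → e))
  ...   | no  c⊈b = ⊥-elim (¬below (λ c⊆b → ⊥-elim (c⊈b c⊆b)))

  Ψ : List (Subset n) → ℕ
  Ψ S = length (J S) + length (minimal S)

  Stable : Fin n → List (Subset n) → Set
  Stable b S = ∀ {v} → v ∈ S → (v ∪ ⁅ b ⁆) ∈ S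

-- Analysis of one rising step T = φ_{S,a}(S).

module RisingStep {n : ℕ} (S : List (Subset n)) (a : Fin n) where

  open DecMembership (_≟ₛ_ {n}) using (_∈?_)

  private
    A : Subset n
    A = ⁅ a ⁆

  T : List (Subset n)
  T = step S a

  step-unique : Unique T
  step-unique = UniqueDecP.deduplicate-! _≟ₛ_ (map (φ S a) S)

  data Move (z : Subset n) : Set where
    stays : (z ∪ A) ∈ S → φ S a z ≡ z     → Move z
    rises : (z ∪ A) ∉ S → φ S a z ≡ z ∪ A → Move z

  φ-stays : ∀ {z} → (z ∪ A) ∈ S → φ S a z ≡ z
  φ-stays {z} z∪a∈S with (z ∪ ⁅ a ⁆) ∈? S
  ... | yes _       = refl
  ... | no  z∪a∉S = ⊥-elim (z∪a∉S z∪a∈S)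

  φ-rises : ∀ {z} → (z ∪ A) ∉ S → φ S a z ≡ z ∪ A
  φ-rises {z} z∪a∉S with (z ∪ ⁅ a ⁆) ∈? S
  ... | yes z∪a∈S = ⊥-elim (z∪a∉S z∪a∈S)
  ... | no  _       = refl

  move : ∀ z → Move z
  move z with (z ∪ A) ∈? S
  ... | yes z∪a∈S = stays z∪a∈S (φ-stays z∪a∈S)
  ... | no  z∪a∉S = rises z∪a∉S (φ-rises z∪a∉S)

  φ-∪a : ∀ z → φ S a z ∪ A ≡ z ∪ A
  φ-∪a z with move z
  ... | stays _ φz≡ = cong (_∪ A) φz≡
  ... | rises _ φz≡ = trans (cong (_∪ A) φz≡) (∪-idemʳ z A)

  rises⇒a∉ : ∀ {u} → u ∈ S → (u ∪ A) ∉ S → a ∉ₛ u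
  rises⇒a∉ {u} u∈S u∪a∉S a∈u = u∪a∉S (subst (_∈ S) (sym (∪⁅⁆-absorb a∈u)) u∈S)

  ∈-T⁺ : ∀ {u} → u ∈ S → φ S a u ∈ T
  ∈-T⁺ u∈S = ∈-deduplicate⁺ _≟ₛ_ (∈-map⁺ (φ S a) u∈S)

  ∈-T⁻ : ∀ {v} → v ∈ T → ∃[ u ] (u ∈ S × v ≡ φ S a u)
  ∈-T⁻ v∈T = ∈-map⁻ (φ S a) (∈-deduplicate⁻ _≟ₛ_ (map (φ S a) S) v∈T)

  data Member (v : Subset n) : Set where
    kept   : v ∈ S → (v ∪ A) ∈ S → Member v
    raised : ∀ u → u ∈ S → (u ∪ A) ∉ S → v ≡ u ∪ A → Member v

  member : ∀ {v} → v ∈ T → Member v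
  member v∈T with ∈-T⁻ v∈T
  ... | u , u∈S , refl with move u
  ...   | stays u∪a∈S φu≡ = subst Member (sym φu≡) (kept u∈S u∪a∈S)
  ...   | rises u∪a∉S φu≡ = raised u u∈S u∪a∉S φu≡

  kept∈T : ∀ {u} → u ∈ S → (u ∪ A) ∈ S → u ∈ T
  kept∈T u∈S u∪a∈S = subst (_∈ T) (φ-stays u∪a∈S) (∈-T⁺ u∈S)

  raised∈T : ∀ {u} → u ∈ S → (u ∪ A) ∈ T
  raised∈T {u} u∈S with move u
  ... | rises _ φu≡ = subst (_∈ T) φu≡ (∈-T⁺ u∈S)
  ... | stays u∪a∈S _ = kept∈T u∪a∈S (subst (_∈ S) (sym (∪-idemʳ u A)) u∪a∈S)

  step-stable : Stable a T
  step-stable v∈T with ∈-T⁻ v∈T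
  ... | u , u∈S , refl = subst (_∈ T) (sym (φ-∪a u)) (raised∈T u∈S)

  step-preserves-stable : ∀ {b} → Stable b S → Stable b T
  step-preserves-stable {b} stable v∈T with ∈-T⁻ v∈T
  ... | u , u∈S , refl with move u
  ...   | stays u∪a∈S φu≡ = subst (λ w → (w ∪ ⁅ b ⁆) ∈ T) (sym φu≡)
            (kept∈T (stable u∈S) (subst (_∈ S) (∪-swapʳ u A ⁅ b ⁆) (stable u∪a∈S)))
  ...   | rises _ φu≡ = subst (λ w → (w ∪ ⁅ b ⁆) ∈ T) (sym φu≡)
            (subst (_∈ T) (∪-swapʳ u ⁅ b ⁆ A) (raised∈T (stable u∈S)))

  raised-∪ : UnionClosed S → ∀ {u t} → u ∈ S → t ∈ T → ((u ∪ A) ∪ t) ∈ T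
  raised-∪ uc {u} u∈S t∈T with ∈-T⁻ t∈T
  ... | t₀ , t₀∈S , refl = subst (_∈ T) (sym eq) (raised∈T (uc u∈S t₀∈S))
    where
    open ≡-Reasoning
    eq : (u ∪ A) ∪ φ S a t₀ ≡ (u ∪ t₀) ∪ A
    eq = begin
      (u ∪ A) ∪ φ S a t₀   ≡⟨ ∪-swapʳ u A (φ S a t₀) ⟩
      (u ∪ φ S a t₀) ∪ A   ≡⟨ ∪-assoc u (φ S a t₀) A ⟩
      u ∪ (φ S a t₀ ∪ A)   ≡⟨ cong (u ∪_) (φ-∪a t₀) ⟩
      u ∪ (t₀ ∪ A)         ≡⟨ sym (∪-assoc u t₀ A) ⟩
      (u ∪ t₀) ∪ A         ∎

  step-unionClosed : UnionClosed S → UnionClosed T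
  step-unionClosed uc {h} {t} h∈T t∈T with member h∈T | member t∈T
  ... | raised u u∈S _ refl | _ = raised-∪ uc u∈S t∈T
  ... | kept _ _ | raised u u∈S _ refl = subst (_∈ T) (∪-comm (u ∪ A) h) (raised-∪ uc u∈S h∈T)
  ... | kept h∈S h∪a∈S | kept t∈S t∪a∈S =
    kept∈T (uc h∈S t∈S) (subst (_∈ S) (∪-distribʳ-self h t A) (uc h∪a∈S t∪a∈S))

  φ-injective : InjectiveOn (φ S a) S
  φ-injective {u} {u′} u∈S u′∈S eq with move u | move u′
  ... | stays _ e | stays _ e′ = trans (sym e) (trans eq e′)
  ... | stays _ e | rises u′∪a∉S e′ = ⊥-elim (u′∪a∉S (subst (_∈ S) (trans (sym e) (trans eq e′)) u∈S))
  ... | rises u∪a∉S e | stays _ e′ = ⊥-elim (u∪a∉S (subst (_∈ S) (trans (sym e′) (trans (sym eq) e)) u′∈S))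
  ... | rises u∪a∉S e | rises u′∪a∉S e′ =
    ∪⁅⁆-cancel (rises⇒a∉ u∈S u∪a∉S) (rises⇒a∉ u′∈S u′∪a∉S) (trans (sym e) (trans eq e′))

  raised-join : ∀ {c m} → c ⊆ m ∪ A → (c ∪ A) ∪ m ≡ m ∪ A
  raised-join {c} {m} c⊆ = trans (∪-swapʳ c A m) (trans (∪-assoc c m A) (⊆⇒∪≡ c⊆))

  φ-minimal : UnionClosed S → ∀ {m} → m ∈ S → IsMin S m → IsMin T (φ S a m)
  φ-minimal uc {m} m∈S m-min with move m
  ... | stays m∪a∈S φm≡ = subst (IsMin T) (sym φm≡) (All.tabulate below)
    where
    below : ∀ {c} → c ∈ T → c ⊆ m → c ≡ m
    below c∈T c⊆m with member c∈T
    ... | kept c∈S _ = minimal-below m-min c∈S c⊆m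
    ... | raised u u∈S u∪a∉S refl =
      ⊥-elim (u∪a∉S (subst (λ w → (w ∪ A) ∈ S)
                           (sym (minimal-below m-min u∈S (λ x∈u → c⊆m (p⊆p∪q A x∈u)))) m∪a∈S))
  ... | rises m∪a∉S φm≡ = subst (IsMin T) (sym φm≡) (All.tabulate below)
    where
    below : ∀ {c} → c ∈ T → c ⊆ m ∪ A → c ≡ m ∪ A
    below c∈T c⊆ with member c∈T
    ... | kept _ c∪a∈S = ⊥-elim (m∪a∉S (subst (_∈ S) (raised-join c⊆) (uc c∪a∈S m∈S)))
    ... | raised u u∈S u∪a∉S refl =
      cong (_∪ A) (minimal-below m-min u∈S (⊆∪⁅⁆⇒⊆ (rises⇒a∉ u∈S u∪a∉S) (λ x∈u → c⊆ (p⊆p∪q A x∈u))))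

  -- The defect of an irreducible g whose image becomes reducible: g arises by
  -- adding a to a residue r ∈ S, and r lies above a member z of S that rises.
  record Defect (g : Subset n) : Set where
    field
      residue         : Subset n
      residue∈S       : residue ∈ S
      a∉residue       : a ∉ₛ residue
      residue∪a       : residue ∪ A ≡ g
      witness         : Subset n
      witness∈S       : witness ∈ S
      witness⊆residue : witness ⊆ residue
      witness-rises   : (witness ∪ A) ∉ S

  -- Main case of the defect construction: φ(g) = h ∪ (z ∪ {a}) with z raised
  -- and neither part equal to φ(g).  Then r = h₀ ∪ z (where h = φ(h₀)) is
  -- the residue.
  defect-from-raised : UnionClosed S → ∀ {g h z} → g ∈ S → IsJ S g → h ∈ T →
    z ∈ S → (z ∪ A) ∉ S → φ S a g ≡ h ∪ (z ∪ A) →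
    h ≢ φ S a g → (z ∪ A) ≢ φ S a g → Defect g
  defect-from-raised uc {g} {h} {z} g∈S gJ h∈T z∈S z∪a∉S split h≢ t≢ with ∈-T⁻ h∈T
  ... | h₀ , h₀∈S , refl = build (move g) (a ∈ₛ? r)
    where
    open ≡-Reasoning
    r : Subset n
    r = h₀ ∪ z
    a∈φg : a ∈ₛ φ S a g
    a∈φg = subst (a ∈ₛ_) (sym split) (q⊆p∪q (φ S a h₀) (z ∪ A) (a∈p∪⁅a⁆ z a))
    g∪a≡φg : g ∪ A ≡ φ S a g
    g∪a≡φg = trans (sym (φ-∪a g)) (∪⁅⁆-absorb a∈φg)
    r∪a≡φg : r ∪ A ≡ φ S a g
    r∪a≡φg = begin
      (h₀ ∪ z) ∪ A            ≡⟨ ∪-swapʳ h₀ z A ⟩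
      (h₀ ∪ A) ∪ z            ≡⟨ cong (_∪ z) (sym (φ-∪a h₀)) ⟩
      (φ S a h₀ ∪ A) ∪ z      ≡⟨ ∪-assoc (φ S a h₀) A z ⟩
      φ S a h₀ ∪ (A ∪ z)      ≡⟨ cong (φ S a h₀ ∪_) (∪-comm A z) ⟩
      φ S a h₀ ∪ (z ∪ A)      ≡⟨ sym split ⟩
      φ S a g                 ∎
    g≢r : g ≢ r
    g≢r g≡r with irreducible gJ h₀∈S z∈S g≡r
    ... | inj₁ h₀≡g = h≢ (cong (φ S a) h₀≡g)
    ... | inj₂ z≡g  = t≢ (trans (cong (_∪ A) z≡g) g∪a≡φg)
    build : Move g → Dec (a ∈ₛ r) → Defect g
    build (rises g∪a∉S φg≡) (yes a∈r) =
      ⊥-elim (g∪a∉S (subst (_∈ S) (trans (sym (∪⁅⁆-absorb a∈r)) (trans r∪a≡φg φg≡)) (uc h₀∈S z∈S)))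
    build (rises g∪a∉S φg≡) (no a∉r) =
      ⊥-elim (g≢r (∪⁅⁆-cancel (rises⇒a∉ g∈S g∪a∉S) a∉r (trans g∪a≡φg (sym r∪a≡φg))))
    build (stays _ φg≡) (yes a∈r) = ⊥-elim (g≢r (sym (trans (sym (∪⁅⁆-absorb a∈r)) (trans r∪a≡φg φg≡))))
    build (stays _ φg≡) (no a∉r) = record
      { residue = r ; residue∈S = uc h₀∈S z∈S ; a∉residue = a∉r ; residue∪a = trans r∪a≡φg φg≡
      ; witness = z ; witness∈S = z∈S ; witness⊆residue = q⊆p∪q h₀ z ; witness-rises = z∪a∉S }

  defect : UnionClosed S → ∀ {g} → g ∈ S → IsJ S g → φ S a g ∉ J T → Defect g
  defect uc {g} g∈S gJ φg∉J with reducible (∈-T⁺ g∈S) φg∉J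
  ... | h , t , h∈T , t∈T , split , h≢ , t≢ with member h∈T | member t∈T
  ... | _ | raised z z∈S z∪a∉S refl = defect-from-raised uc g∈S gJ h∈T z∈S z∪a∉S split h≢ t≢
  ... | raised z z∈S z∪a∉S refl | kept _ _ =
    defect-from-raised uc g∈S gJ t∈T z∈S z∪a∉S (trans split (∪-comm (z ∪ A) t)) t≢ h≢
  ... | kept h∈S _ | kept t∈S _ with move g
  ...   | rises g∪a∉S φg≡ = ⊥-elim (g∪a∉S (subst (_∈ S) (trans (sym split) φg≡) (uc h∈S t∈S)))
  ...   | stays _ φg≡ with irreducible gJ h∈S t∈S (trans (sym φg≡) split)
  ...     | inj₁ h≡g = ⊥-elim (h≢ (trans h≡g (sym φg≡)))
  ...     | inj₂ t≡g = ⊥-elim (t≢ (trans t≡g (sym φg≡)))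

  module _ {g : Subset n} (D : Defect g) where
    open Defect D

    a∈g : a ∈ₛ g
    a∈g = subst (a ∈ₛ_) residue∪a (a∈p∪⁅a⁆ residue a)

    g-a≡residue : g - a ≡ residue
    g-a≡residue = trans (cong (_- a) (sym residue∪a)) (∪⁅⁆- a∉residue)

    residue∈T : g ∈ S → residue ∈ T
    residue∈T g∈S = kept∈T residue∈S (subst (_∈ S) (sym residue∪a) g∈S)

    -- The residue is not minimal in S: the witness lies strictly below it.
    residue-not-minimal : g ∈ S → ¬ IsMin S residue
    residue-not-minimal g∈S r-min = witness-rises
      (subst (λ w → (w ∪ A) ∈ S) (sym (minimal-below r-min witness∈S witness⊆residue))
             (subst (_∈ S) (sym residue∪a) g∈S))

    -- The residue is minimal in T, by irreducibility of g.
    residue-minimal : IsJ S g → IsMin T residue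
    residue-minimal gJ = All.tabulate below
      where
      below : ∀ {c} → c ∈ T → c ⊆ residue → c ≡ residue
      below c∈T c⊆r with member c∈T
      ... | raised u _ _ refl = ⊥-elim (a∉residue (c⊆r (a∈p∪⁅a⁆ u a)))
      ... | kept _ c∪a∈S
        with irreducible gJ c∪a∈S residue∈S
               (sym (trans (raised-join (λ x∈c → p⊆p∪q A (c⊆r x∈c))) residue∪a))
      ...   | inj₁ c∪a≡g = ∪⁅⁆-cancel (λ a∈c → a∉residue (c⊆r a∈c)) a∉residue (trans c∪a≡g (sym residue∪a))
      ...   | inj₂ r≡g   = ⊥-elim (a∉residue (subst (a ∈ₛ_) (sym r≡g) a∈g))

  -- The counting argument, for union-closed duplicate-free S.  J(S) splits
  -- into good members (φ(g) ∈ J(T)) and bad ones (which have a defect).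
  module _ (uc : UnionClosed S) (uS : Unique S) where

    good? : (g : Subset n) → Dec (φ S a g ∈ J T)
    good? g = φ S a g ∈? J T

    good bad : List (Subset n)
    good = filter good? (J S)
    bad  = filter (¬? ∘ good?) (J S)

    private
      uJ : Unique (J S)
      uJ = UniqueP.filter⁺ (IsJ? S) uS
      good⁻ : ∀ {g} → g ∈ good → g ∈ J S × φ S a g ∈ J T
      good⁻ = ∈-filter⁻ good?
      bad⁻ : ∀ {g} → g ∈ bad → g ∈ J S × φ S a g ∉ J T
      bad⁻ = ∈-filter⁻ (¬? ∘ good?)
      in-S : ∀ {g} → g ∈ J S → g ∈ S
      in-S g∈J = proj₁ (∈-J⁻ g∈J)
      defect-of : ∀ {g} → g ∈ bad → Defect g
      defect-of g∈bad with bad⁻ g∈bad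
      ... | g∈J , φg∉J = defect uc (in-S g∈J) (proj₂ (∈-J⁻ g∈J)) φg∉J

    good-bound : length good ≤ length (J T)
    good-bound = injection-length (φ S a) (UniqueP.filter⁺ good? uJ)
      (λ x y → φ-injective (in-S (proj₁ (good⁻ x))) (in-S (proj₁ (good⁻ y)))) (proj₂ ∘ good⁻)

    -- A minimal member and a bad member never meet in min(T): a raised
    -- minimal member contains a, and a kept one is minimal in S.
    apart : ∀ {m g} → m ∈ minimal S → g ∈ bad → φ S a m ≢ g - a
    apart {m} {g} m∈min g∈bad φm≡ with move m
    ... | rises _ φm≡′ = x∉p-x g a (subst (a ∈ₛ_) φm≡ (subst (a ∈ₛ_) (sym φm≡′) (a∈p∪⁅a⁆ m a)))
    ... | stays _ φm≡′ = residue-not-minimal (defect-of g∈bad) (in-S (proj₁ (bad⁻ g∈bad)))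
      (subst (IsMin S) (trans (sym φm≡′) (trans φm≡ (g-a≡residue (defect-of g∈bad)))) (proj₂ (∈-minimal⁻ m∈min)))

    -- min(S) (via φ) and the bad members (via g ↦ g - a) inject disjointly
    -- into min(T).
    minimal-bound : length (minimal S) + length bad ≤ length (minimal T)
    minimal-bound = disjoint-injections-length (φ S a) (_- a)
      (UniqueP.filter⁺ (IsMin? S) uS) (UniqueP.filter⁺ (¬? ∘ good?) uJ)
      (λ x y → φ-injective (proj₁ (∈-minimal⁻ x)) (proj₁ (∈-minimal⁻ y)))
      (λ x y g-a≡ → trans (sym (-∪⁅⁆ (a∈g (defect-of x))))
                          (trans (cong (_∪ A) g-a≡) (-∪⁅⁆ (a∈g (defect-of y)))))
      apart
      (λ m∈min → let m∈S , m-min = ∈-minimal⁻ m∈min in ∈-minimal⁺ (∈-T⁺ m∈S) (φ-minimal uc m∈S m-min))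
      (λ g∈bad → let D = defect-of g∈bad ; g∈J = proj₁ (bad⁻ g∈bad) in
        subst (_∈ minimal T) (sym (g-a≡residue D))
              (∈-minimal⁺ (residue∈T D (in-S g∈J)) (residue-minimal D (proj₂ (∈-J⁻ g∈J)))))

    Ψ-step : Ψ S ≤ Ψ T
    Ψ-step = begin
      length (J S) + length (minimal S)               ≡⟨ cong (_+ length (minimal S)) (length-filter-split good? (J S)) ⟩
      (length good + length bad) + length (minimal S) ≡⟨ +-assoc (length good) (length bad) _ ⟩
      length good + (length bad + length (minimal S)) ≡⟨ cong (length good +_) (+-comm (length bad) _) ⟩
      length good + (length (minimal S) + length bad) ≤⟨ +-mono-≤ good-bound minimal-bound ⟩
      length (J T) + length (minimal T)               ∎
      where open ≤-Reasoning

-- Irreducible members of up-sets.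

module _ {n : ℕ} where

  UpClosed : List (Subset n) → Set
  UpClosed U = ∀ {c s} → c ∈ U → c ⊆ s → s ∈ U

  addAll : List (Fin n) → Subset n → Subset n
  addAll []      c = c
  addAll (i ∷ l) c = addAll l c ∪ ⁅ i ⁆

  ∈-addAll⁻ : ∀ l {c x} → x ∈ₛ addAll l c → x ∈ₛ c ⊎ x ∈ l
  ∈-addAll⁻ []      x∈ = inj₁ x∈
  ∈-addAll⁻ (i ∷ l) {c} x∈ with x∈p∪q⁻ (addAll l c) ⁅ i ⁆ x∈
  ... | inj₂ x∈i = inj₂ (here (x∈⁅y⁆⇒x≡y i x∈i))
  ... | inj₁ x∈l with ∈-addAll⁻ l x∈l
  ...   | inj₁ x∈c = inj₁ x∈c
  ...   | inj₂ x∈l′ = inj₂ (there x∈l′)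

  ∈-addAll⁺ : ∀ l {c x} → x ∈ₛ c ⊎ x ∈ l → x ∈ₛ addAll l c
  ∈-addAll⁺ []      (inj₁ x∈c)         = x∈c
  ∈-addAll⁺ (i ∷ l) {c} (inj₂ (here refl)) = a∈p∪⁅a⁆ (addAll l c) i
  ∈-addAll⁺ (i ∷ l) (inj₁ x∈c)         = p⊆p∪q ⁅ i ⁆ (∈-addAll⁺ l (inj₁ x∈c))
  ∈-addAll⁺ (i ∷ l) (inj₂ (there x∈l)) = p⊆p∪q ⁅ i ⁆ (∈-addAll⁺ l (inj₂ x∈l))

  stable⇒upClosed : ∀ {U : List (Subset n)} → (∀ b → Stable b U) → UpClosed U
  stable⇒upClosed {U} stable {c} {s} c∈U c⊆s = subst (_∈ U) addAll≡s (addAll∈U points c∈U)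
    where
    points : List (Fin n)
    points = filter (_∈ₛ? s) (allFin n)
    addAll∈U : ∀ l {c} → c ∈ U → addAll l c ∈ U
    addAll∈U []      c∈U = c∈U
    addAll∈U (i ∷ l) c∈U = stable i (addAll∈U l c∈U)
    addAll≡s : addAll points c ≡ s
    addAll≡s = ⊆-antisym
      (λ x∈ → [ c⊆s , (λ x∈p → proj₂ (∈-filter⁻ (_∈ₛ? s) {xs = allFin n} x∈p)) ]′ (∈-addAll⁻ points x∈))
      (λ {x} x∈s → ∈-addAll⁺ points (inj₂ (∈-filter⁺ (_∈ₛ? s) (∈-allFin x) x∈s)))

  -- In an up-set, an irreducible g cannot lose either of two distinct points
  -- x, y ∈ g and stay in the family, since g = (g - x) ∪ (g - y).
  irreducible-rigid : ∀ {U : List (Subset n)} {g x y} → IsJ U g → x ≢ y →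
    x ∈ₛ g → y ∈ₛ g → (g - x) ∈ U → (g - y) ∈ U → ⊥
  irreducible-rigid {g = g} gJ x≢y x∈g y∈g g-x∈U g-y∈U
    with irreducible gJ g-x∈U g-y∈U (split-by-two g x≢y)
  ... | inj₁ g-x≡g = p-x≢p x∈g g-x≡g
  ... | inj₂ g-y≡g = p-x≢p y∈g g-y≡g

  irreducible-level : ∀ {U : List (Subset n)} → UpClosed U → ∀ {g} → g ∈ J U →
    g ∈ minimal U ⊎ g ∈ minimal (U ∖ minimal U)
  irreducible-level {U} up {g} g∈J with ∈-J⁻ g∈J
  ... | g∈U , gJ with IsMin? U g
  ...   | yes g-min = inj₁ (∈-minimal⁺ g∈U g-min)
  ...   | no  g-not-min = inj₂ (∈-minimal⁺ (upper g∈U g∉min) (All.tabulate below))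
    where
    open DecMembership (_≟ₛ_ {n}) using (_∈?_)
    upper : ∀ {d} → d ∈ U → d ∉ minimal U → d ∈ U ∖ minimal U
    upper = ∈-filter⁺ (λ b → ¬? (b ∈? minimal U))
    g∉min : g ∉ minimal U
    g∉min g∈min = g-not-min (proj₂ (∈-minimal⁻ g∈min))
    below : ∀ {d} → d ∈ U ∖ minimal U → d ⊆ g → d ≡ g
    below {d} d∈ d⊆g with ∈-filter⁻ (λ b → ¬? (b ∈? minimal U)) d∈ | d ≟ₛ g
    ... | _ | yes d≡g = d≡g
    ... | d∈U , d∉min | no d≢g with non-minimal d∈U d∉min
    ...   | e , e∈U , e⊆d , e≢d with missing-point e⊆d e≢d | missing-point d⊆g d≢g
    ...     | x , x∈d , x∉e | y , y∈g , y∉d = ⊥-elim (irreducible-rigid gJ x≢y (d⊆g x∈d) y∈g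
                (up e∈U (⊆-remove (λ i∈e → d⊆g (e⊆d i∈e)) x∉e)) (up d∈U (⊆-remove d⊆g y∉d)))
      where
      x≢y : x ≢ y
      x≢y refl = y∉d x∈d

  J-bound : ∀ {U : List (Subset n)} → UpClosed U → Unique U →
    length (J U) ≤ length (minimal U) + length (minimal (U ∖ minimal U))
  J-bound {U} up uU = begin
    length (J U)                                     ≤⟨ unique-⊆-length (UniqueP.filter⁺ (IsJ? U) uU) J⊆ ⟩
    length (minimal U ++ minimal (U ∖ minimal U))    ≡⟨ length-++ (minimal U) ⟩
    length (minimal U) + length (minimal (U ∖ minimal U)) ∎
    where
    open ≤-Reasoning
    J⊆ : ∀ {g} → g ∈ J U → g ∈ minimal U ++ minimal (U ∖ minimal U)
    J⊆ g∈J = [ ∈-++⁺ˡ , ∈-++⁺ʳ (minimal U) ]′ (irreducible-level up g∈J)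

-- Iterating rising steps along a word.

module _ {n : ℕ} where

  open RisingStep using (Ψ-step; step-unionClosed; step-unique; step-stable; step-preserves-stable)

  risingImage-[] : ∀ {S : List (Subset n)} → Unique S → risingImage [] S ≡ S
  risingImage-[] = deduplicate-unique _≟ₛ_

  risingImage-unique : ∀ u (S : List (Subset n)) → Unique S → Unique (risingImage u S)
  risingImage-unique []      S uS = subst Unique (sym (risingImage-[] uS)) uS
  risingImage-unique (a ∷ u) S _  = risingImage-unique u (step S a) (step-unique S a)

  Ψ-rising : ∀ u (S : List (Subset n)) → UnionClosed S → Unique S → Ψ S ≤ Ψ (risingImage u S)
  Ψ-rising []      S _  uS = ≤-reflexive (cong Ψ (sym (risingImage-[] uS)))
  Ψ-rising (a ∷ u) S uc uS =
    ≤-trans (Ψ-step S a uc uS) (Ψ-rising u (step S a) (step-unionClosed S a uc) (step-unique S a))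

  rising-stable : ∀ u (S : List (Subset n)) → Unique S → (∀ b → Stable b S ⊎ b ∈ u) →
    ∀ b → Stable b (risingImage u S)
  rising-stable [] S uS covered b with covered b
  ... | inj₁ stable = subst (Stable b) (sym (risingImage-[] uS)) stable
  ... | inj₂ ()
  rising-stable (a ∷ u) S _ covered = rising-stable u (step S a) (step-unique S a) covered′
    where
    covered′ : ∀ b → Stable b (step S a) ⊎ b ∈ u
    covered′ b with covered b
    ... | inj₁ stable          = inj₁ (step-preserves-stable S a stable)
    ... | inj₂ (here refl)     = inj₁ (step-stable S a)
    ... | inj₂ (there b∈u)     = inj₂ b∈u

collect : ∀ m k → (m + k) + m ≡ 2 * m + k
collect = solve-∀

theorem6p5 : (n : ℕ) (F : List (Subset n)) → Unique F → UnionClosed F → ⋃ F ≡ ⊤ →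
    length (J F) ≤ 2 * length (minimal (risingImage w F))
    + length (minimal (risingImage w F ∖ minimal (risingImage w F)))
theorem6p5 n F uF ucF _ = begin
  length (J F)                 ≤⟨ m≤m+n (length (J F)) (length (minimal F)) ⟩
  Ψ F                          ≤⟨ Ψ-rising w F ucF uF ⟩
  length (J U) + M             ≤⟨ +-monoˡ-≤ M (J-bound upU (risingImage-unique w F uF)) ⟩
  (M + M₂) + M                 ≡⟨ collect M M₂ ⟩
  2 * M + M₂                   ∎
  where
  open ≤-Reasoning
  U : List (Subset n)
  U = risingImage w F
  M M₂ : ℕ
  M  = length (minimal U)
  M₂ = length (minimal (U ∖ minimal U))
  upU : UpClosed U
  upU = stable⇒upClosed (rising-stable w F uF (λ b → inj₂ (∈-allFin b)))
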